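{- Let $r\ge2$ be an integer and let $H\subseteq\mathbb{N}$ be a $\Delta_r^*$-set. Then, as $N\to\infty$, \[ \frac{|H\cap[1,N]|}{N}\ge\frac{1}{r-1}\prod_{p\le r-1}\left(1-p^{ -1}\right)+o(1), \] where the product runs over primes $p\le r-1$.
   Context: $\mathbb{N}$ denotes the positive integers. For a nonempty $S\subseteq\mathbb{N}$, its difference set is $\Delta(S)=\{a-b:\ a,b\in S,\ a>b\}$. A set $A\subseteq\mathbb{N}$ is a $\Delta_r^*$-set if $A\cap\Delta(S)\neq\emptyset$ for every $S\subseteq\mathbb{N}$ with $|S|\ge r$. -}

module Defs where

open import Data.Bool using (Bool; true; false; if_then_else_)
open import Data.Nat as ℕ using (ℕ; zero; suc; _≤_; _<_; _∸_)
open import Data.Nat.Primality using (prime?)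
open import Data.Integer using (+_)
open import Data.Rational using (ℚ; _/_; _*_; _-_; 1ℚ; 0ℚ)
open import Data.List using (List; length)
open import Data.List.Membership.Propositional using (_∈_)
open import Data.List.Relation.Unary.All using (All)
open import Data.List.Relation.Unary.Unique.Propositional using (Unique)
open import Data.Product using (∃-syntax; _×_)
open import Relation.Binary.PropositionalEquality using (_≡_)
open import Relation.Nullary.Decidable using (does)

-- Subsets of ℕ are represented by characteristic functions ℕ → Bool
-- (only values at positive integers are relevant).

-- A is a Δ_r^*-set: for every set S of at least r positive integers,
-- A meets the difference set Δ(S).  It suffices (and is equivalent) to
-- quantify over finite S, given as duplicate-free lists.
IsΔStar : ℕ → (ℕ → Bool) → Set
IsΔStar r A =
  (S : List ℕ) → Unique S → All (λ x → 1 ≤ x) S → r ≤ length S →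
  ∃[ a ] ∃[ b ] (a ∈ S × b ∈ S × b < a × A (a ∸ b) ≡ true)

count : (ℕ → Bool) → ℕ → ℕ
count A zero = zero
count A (suc n) = if A (suc n) then suc (count A n) else count A n

primeProd : ℕ → ℚ
primeProd zero = 1ℚ
primeProd (suc n) =
  if does (prime? (suc n)) then primeProd n * (1ℚ - (+ 1 / suc n)) else primeProd n

-- (1/(r-1)) ∏_{p ≤ r-1} (1 - 1/p), for r ≥ 2 (value for r < 2 is irrelevant)
bound : ℕ → ℚ
bound (suc (suc k)) = (+ 1 / suc k) * primeProd (suc k)
bound _ = 0ℚ

{-# OPTIONS --safe #-}
module Submission where

-- Let K = r - 1 and call x K-rough if no d ∈ [2, K] divides x.  Applying the Δ*_r property to
-- {x, 2x, …, r x} yields some j ∈ [1, K] with j x ∈ H, and x ↦ j x is injective on K-rough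
-- numbers (j x = j′ y forces x ∣ y and y ∣ x), so |H ∩ [1, K M]| ≥ #{K-rough x ≤ M}.  The
-- K-rough numbers are periodic modulo K!, and sieving one prime at a time shows that a period
-- contains φ(K!) = K! ∏_{p ≤ K} (1 - 1/p) of them; hence |H ∩ [1, N]| / N ≥ φ(K!)/(K · K!) - φ(K!)/N.

open import Defs
open import Data.Bool using (Bool; true; false; if_then_else_; _∧_; not)
open import Data.Bool.Properties using (∧-zeroʳ; ∧-identityʳ)
open import Data.Nat as ℕ using (ℕ; zero; suc; _+_; _*_; _∸_; _≤_; _<_; _!; _≟_; NonZero; z≤n; s≤s)
open import Data.Nat.Properties
open import Data.Nat.Divisibility
  using (_∣_; _∣?_; ∣-refl; 0∣⇒≡0; ∣-trans; ∣-antisym; ∣⇒≤; m∣m*n; n∣m*n;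
         ∣m∣n⇒∣m+n; ∣m+n∣m⇒∣n; m≤n⇒m!∣n!)
open import Data.Nat.Primality using (Prime; prime?; composite; ¬prime⇒composite)
open import Data.Nat.Coprimality using (Coprime; coprime-divisor; prime⇒coprime)
import Data.Nat.Coprimality as Coprime
open import Data.Product using (∃-syntax; _×_; _,_; proj₁; proj₂)
open import Data.Sum using (inj₁; inj₂)
open import Relation.Nullary using (¬_; Dec; yes; no; does; contradiction)
open import Relation.Nullary.Decidable using (dec-true; dec-false; does-⇔)
open import Function.Bundles using (_⇔_; mk⇔)
open import Data.List using (applyUpTo)
open import Data.List.Properties using (length-applyUpTo)
open import Data.List.Membership.Propositional.Properties using (∈-applyUpTo⁻)
import Data.List.Relation.Unary.Unique.Propositional.Properties as Unique
import Data.List.Relation.Unary.All.Properties as All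
open import Data.Nat.DivMod using (m≡m%n+[m/n]*n; m%n<n; m/n*n≤m)
open import Relation.Binary.PropositionalEquality

count-cong : ∀ (f g : ℕ → Bool) n → (∀ x → 1 ≤ x → x ≤ n → f x ≡ g x) → count f n ≡ count g n
count-cong f g zero f≗g = refl
count-cong f g (suc n) f≗g with f (suc n) | g (suc n) | f≗g (suc n) (s≤s z≤n) ≤-refl
  | count-cong f g n (λ x 1≤x x≤n → f≗g x 1≤x (m≤n⇒m≤1+n x≤n))
... | true  | true  | _ | eq = cong suc eq
... | false | false | _ | eq = eq

count-+ : ∀ (f : ℕ → Bool) m n → count f (m + n) ≡ count f m + count (λ x → f (m + x)) n
count-+ f m zero rewrite +-identityʳ m = sym (+-identityʳ _)
count-+ f m (suc n) rewrite +-suc m n with f (suc (m + n)) | count-+ f m n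
... | true  | eq = trans (cong suc eq) (sym (+-suc _ _))
... | false | eq = eq

count-periodic : ∀ (f : ℕ → Bool) L → (∀ x → f (L + x) ≡ f x) → ∀ q → count f (q * L) ≡ q * count f L
count-periodic f L periodic zero = refl
count-periodic f L periodic (suc q) = begin
  count f (L + q * L)                          ≡⟨ count-+ f L (q * L) ⟩
  count f L + count (λ x → f (L + x)) (q * L)  ≡⟨ cong (count f L +_) (count-cong _ f (q * L) (λ x _ _ → periodic x)) ⟩
  count f L + count f (q * L)                  ≡⟨ cong (count f L +_) (count-periodic f L periodic q) ⟩
  count f L + q * count f L                    ∎
  where open ≡-Reasoning

count-partition : ∀ (f g : ℕ → Bool) n →
  count f n ≡ count (λ x → f x ∧ g x) n + count (λ x → f x ∧ not (g x)) n
count-partition f g zero = refl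
count-partition f g (suc n) with f (suc n) | g (suc n) | count-partition f g n
... | true  | true  | eq = cong suc eq
... | true  | false | eq = trans (cong suc eq) (sym (+-suc _ _))
... | false | _     | eq = eq

count-mono : ∀ (f : ℕ → Bool) {m n} → m ≤ n → count f m ≤ count f n
count-mono f {n = zero} z≤n = ≤-refl
count-mono f {n = suc n} m≤1+n with m≤n⇒m<n∨m≡n m≤1+n
... | inj₂ refl = ≤-refl
... | inj₁ (s≤s m≤n) with f (suc n)
...   | true  = m≤n⇒m≤1+n (count-mono f m≤n)
...   | false = count-mono f m≤n

count-false : ∀ (f : ℕ → Bool) n → (∀ x → 1 ≤ x → x ≤ n → f x ≡ false) → count f n ≡ 0
count-false f zero _ = refl
count-false f (suc n) f≡false rewrite f≡false (suc n) (s≤s z≤n) ≤-refl =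
  count-false f n (λ x 1≤x x≤n → f≡false x 1≤x (m≤n⇒m≤1+n x≤n))

∣?-false-below : ∀ p x → 1 ≤ x → x < p → does (p ∣? x) ≡ false
∣?-false-below p x@(suc _) _ x<p = dec-false (p ∣? x) (λ p∣x → <⇒≱ x<p (∣⇒≤ p∣x))

count-multiples-block : ∀ p .{{_ : NonZero p}} (f : ℕ → Bool) →
  count (λ x → f x ∧ does (p ∣? x)) p ≡ count (λ y → f (y * p)) 1
count-multiples-block p@(suc q) f
  rewrite count-false (λ x → f x ∧ does (p ∣? x)) q
            (λ x 1≤x x≤q → trans (cong (f x ∧_) (∣?-false-below p x 1≤x (s≤s x≤q))) (∧-zeroʳ (f x)))
        | +-identityʳ p | dec-true (p ∣? p) ∣-refl | ∧-identityʳ (f p) = refl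

∣?-+ : ∀ p x → does (p ∣? (p + x)) ≡ does (p ∣? x)
∣?-+ p x =
  does-⇔ (mk⇔ (λ p∣p+x → ∣m+n∣m⇒∣n p∣p+x ∣-refl) (∣m∣n⇒∣m+n ∣-refl)) (p ∣? (p + x)) (p ∣? x)

count-multiples : ∀ p .{{_ : NonZero p}} (f : ℕ → Bool) n →
  count (λ x → f x ∧ does (p ∣? x)) (n * p) ≡ count (λ y → f (y * p)) n
count-multiples p f zero = refl
count-multiples p f (suc n) = begin
  count (λ x → f x ∧ does (p ∣? x)) (p + n * p)
    ≡⟨ count-+ _ p (n * p) ⟩
  count (λ x → f x ∧ does (p ∣? x)) p + count (λ x → f (p + x) ∧ does (p ∣? (p + x))) (n * p)
    ≡⟨ cong₂ _+_ (count-multiples-block p f)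
         (count-cong _ _ (n * p) (λ x _ _ → cong (f (p + x) ∧_) (∣?-+ p x))) ⟩
  count (λ y → f (y * p)) 1 + count (λ x → f (p + x) ∧ does (p ∣? x)) (n * p)
    ≡⟨ cong (count (λ y → f (y * p)) 1 +_) (count-multiples p (λ x → f (p + x)) n) ⟩
  count (λ y → f (y * p)) 1 + count (λ y → f (p + y * p)) n
    ≡⟨ count-+ (λ y → f (y * p)) 1 n ⟨
  count (λ y → f (y * p)) (suc n) ∎
  where open ≡-Reasoning

erase : (ℕ → Bool) → ℕ → ℕ → Bool
erase f t x = if does (x ≟ t) then false else f x

erase-≢ : ∀ f t x → x ≢ t → erase f t x ≡ f x
erase-≢ f t x x≢t = cong (λ b → if b then false else f x) (dec-false (x ≟ t) x≢t)

count-erase : ∀ f t n → f t ≡ true → 1 ≤ t → t ≤ n → suc (count (erase f t) n) ≡ count f n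
count-erase f (suc _) zero _ _ ()
count-erase f t (suc n) ft 1≤t t≤1+n with m≤n⇒m<n∨m≡n t≤1+n
... | inj₂ refl rewrite ft | dec-true (suc n ≟ suc n) refl =
  cong suc (count-cong _ _ n (λ x _ x≤n → erase-≢ f (suc n) x (λ { refl → 1+n≰n x≤n })))
... | inj₁ (s≤s t≤n) rewrite erase-≢ f t (suc n) (λ { refl → 1+n≰n t≤n }) with f (suc n)
...   | true  = cong suc (count-erase f t n ft 1≤t t≤n)
...   | false = count-erase f t n ft 1≤t t≤n

count-≤-injection : ∀ (g f : ℕ → Bool) (h : ℕ → ℕ) m n →
  (∀ x → 1 ≤ x → x ≤ m → g x ≡ true → f (h x) ≡ true × 1 ≤ h x × h x ≤ n) →
  (∀ x y → 1 ≤ x → x ≤ m → 1 ≤ y → y ≤ m → g x ≡ true → g y ≡ true → h x ≡ h y → x ≡ y) →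
  count g m ≤ count f n
count-≤-injection g f h zero n maps-to injective = z≤n
count-≤-injection g f h (suc m) n maps-to injective with g (suc m) in g[1+m]
... | false = count-≤-injection g f h m n
                (λ x 1≤x x≤m → maps-to x 1≤x (m≤n⇒m≤1+n x≤m))
                (λ x y 1≤x x≤m 1≤y y≤m → injective x y 1≤x (m≤n⇒m≤1+n x≤m) 1≤y (m≤n⇒m≤1+n y≤m))
... | true with maps-to (suc m) (s≤s z≤n) ≤-refl g[1+m]
...   | f[t] , 1≤t , t≤n = subst (suc (count g m) ≤_) (count-erase f (h (suc m)) n f[t] 1≤t t≤n)
          (s≤s (count-≤-injection g (erase f (h (suc m))) h m n maps-to′
            (λ x y 1≤x x≤m 1≤y y≤m → injective x y 1≤x (m≤n⇒m≤1+n x≤m) 1≤y (m≤n⇒m≤1+n y≤m))))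
  where
  maps-to′ : ∀ x → 1 ≤ x → x ≤ m → g x ≡ true → erase f (h (suc m)) (h x) ≡ true × 1 ≤ h x × h x ≤ n
  maps-to′ x 1≤x x≤m gx with maps-to x 1≤x (m≤n⇒m≤1+n x≤m) gx
  ... | f[hx] , 1≤hx , hx≤n = trans (erase-≢ f _ _ hx≢t) f[hx] , 1≤hx , hx≤n
    where
    hx≢t : h x ≢ h (suc m)
    hx≢t eq with injective x (suc m) 1≤x (m≤n⇒m≤1+n x≤m) (s≤s z≤n) ≤-refl gx g[1+m] eq
    ... | refl = 1+n≰n x≤m

rough : ℕ → ℕ → Bool
rough zero          x = true
rough (suc zero)    x = true
rough (suc (suc k)) x = rough (suc k) x ∧ not (does (suc (suc k) ∣? x))

∧-not-≡true : ∀ {a b} → a ∧ not b ≡ true → a ≡ true × b ≡ false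
∧-not-≡true {true} {false} _ = refl , refl

∤-extend : ∀ {n x} → (∀ d → 2 ≤ d → d ≤ n → ¬ d ∣ x) → ¬ suc n ∣ x →
  ∀ d → 2 ≤ d → d ≤ suc n → ¬ d ∣ x
∤-extend ∤x n+1∤x d 2≤d d≤n+1 with m≤n⇒m<n∨m≡n d≤n+1
... | inj₁ (s≤s d≤n) = ∤x d 2≤d d≤n
... | inj₂ refl      = n+1∤x

rough⇒∤ : ∀ K x → rough K x ≡ true → ∀ d → 2 ≤ d → d ≤ K → ¬ d ∣ x
rough⇒∤ (suc zero)    x _       (suc (suc _)) (s≤s (s≤s _)) (s≤s ())
rough⇒∤ (suc (suc k)) x rough-x = ∤-extend (rough⇒∤ (suc k) x rough′-x) k+2∤x
  where
  rough′-x : rough (suc k) x ≡ true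
  rough′-x = proj₁ (∧-not-≡true rough-x)
  k+2∤x : ¬ suc (suc k) ∣ x
  k+2∤x k+2∣x with () ← trans (sym (dec-true (_ ∣? x) k+2∣x)) (proj₂ (∧-not-≡true {rough (suc k) x} rough-x))

rough-cong : ∀ K {x y} → (∀ d → 2 ≤ d → d ≤ K → (d ∣ x ⇔ d ∣ y)) → rough K x ≡ rough K y
rough-cong zero          _ = refl
rough-cong (suc zero)    _ = refl
rough-cong (suc (suc k)) {x} {y} ∣⇔∣ = cong₂ (λ a b → a ∧ not b)
  (rough-cong (suc k) (λ d 2≤d d≤k+1 → ∣⇔∣ d 2≤d (m≤n⇒m≤1+n d≤k+1)))
  (does-⇔ (∣⇔∣ (suc (suc k)) (s≤s (s≤s z≤n)) ≤-refl) (suc (suc k) ∣? x) (suc (suc k) ∣? y))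

∣-! : ∀ {d n} → 1 ≤ d → d ≤ n → d ∣ n !
∣-! {suc d} _ d≤n = ∣-trans (m∣m*n (d !)) (m≤n⇒m!∣n! d≤n)

rough-periodic : ∀ K x → rough K (K ! + x) ≡ rough K x
rough-periodic K x = rough-cong K (λ d 2≤d d≤K →
  let d∣K! = ∣-! (≤-trans (s≤s z≤n) 2≤d) d≤K in
  mk⇔ (λ d∣K!+x → ∣m+n∣m⇒∣n d∣K!+x d∣K!) (∣m∣n⇒∣m+n d∣K!))

rough-*-prime : ∀ K {p} → Prime p → K < p → ∀ y → rough K (y * p) ≡ rough K y
rough-*-prime K {p} prime-p K<p y = rough-cong K (λ d 2≤d d≤K →
  mk⇔ (λ d∣yp → coprime-divisor (d-coprime-p d 2≤d d≤K) (subst (d ∣_) (*-comm y p) d∣yp))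
      (λ d∣y → ∣-trans d∣y (m∣m*n p)))
  where
  d-coprime-p : ∀ d → 2 ≤ d → d ≤ K → Coprime d p
  d-coprime-p d 2≤d d≤K =
    Coprime.sym (prime⇒coprime prime-p {{ℕ.>-nonZero (<-trans (s≤s z≤n) 2≤d)}} (≤-<-trans d≤K K<p))

rough-composite : ∀ k → ¬ Prime (suc (suc k)) → ∀ x → rough (suc (suc k)) x ≡ rough (suc k) x
rough-composite k ¬prime x with rough (suc k) x in rough′-x
... | false = refl
... | true  = cong not (dec-false (suc (suc k) ∣? x) k+2∤x)
  where
  k+2∤x : ¬ suc (suc k) ∣ x
  k+2∤x k+2∣x with ¬prime⇒composite ¬prime
  ... | composite {d} (s≤s d≤k+1) d∣k+2 =
    rough⇒∤ (suc k) x rough′-x d (ℕ.nonTrivial⇒n>1 d) d≤k+1 (∣-trans d∣k+2 k+2∣x)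

-- φ! n = φ(n !) = n ! ∏_{p ≤ n} (1 - 1/p), the numerator of primeProd n over n !
φ! : ℕ → ℕ
φ! zero    = 1
φ! (suc n) = if does (prime? (suc n)) then n * φ! n else suc n * φ! n

if-does-yes : ∀ {a p} {A : Set a} {P : Set p} (P? : Dec P) → P → {x y : A} → (if does P? then x else y) ≡ x
if-does-yes P? p {x} {y} = cong (λ b → if b then x else y) (dec-true P? p)

if-does-no : ∀ {a p} {A : Set a} {P : Set p} (P? : Dec P) → ¬ P → {x y : A} → (if does P? then x else y) ≡ y
if-does-no P? ¬p {x} {y} = cong (λ b → if b then x else y) (dec-false P? ¬p)

module _ (k : ℕ) (ih : count (rough (suc k)) (suc k !) ≡ φ! (suc k)) where
  private
    P L c : ℕ
    P = suc (suc k)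
    L = suc k !
    c = φ! (suc k)

    count-rough-suc : count (rough (suc k)) (P * L) ≡ P * c
    count-rough-suc = trans (count-periodic _ L (rough-periodic (suc k)) P) (cong (P *_) ih)

    count-rough-multiples : Prime P → count (λ x → rough (suc k) x ∧ does (P ∣? x)) (P * L) ≡ c
    count-rough-multiples prime-P = begin
      count (λ x → rough (suc k) x ∧ does (P ∣? x)) (P * L)  ≡⟨ cong (count _) (*-comm P L) ⟩
      count (λ x → rough (suc k) x ∧ does (P ∣? x)) (L * P)  ≡⟨ count-multiples P (rough (suc k)) L ⟩
      count (λ y → rough (suc k) (y * P)) L
        ≡⟨ count-cong _ _ L (λ y _ _ → rough-*-prime (suc k) prime-P ≤-refl y) ⟩
      count (rough (suc k)) L                                 ≡⟨ ih ⟩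
      c                                                       ∎
      where open ≡-Reasoning

    count-rough-prime : Prime P → count (rough P) (P * L) + c ≡ suc k * c + c
    count-rough-prime prime-P = begin
      count (rough P) (P * L) + c
        ≡⟨ cong (count (rough P) (P * L) +_) (count-rough-multiples prime-P) ⟨
      count (rough P) (P * L) + count (λ x → rough (suc k) x ∧ does (P ∣? x)) (P * L)
        ≡⟨ +-comm (count (rough P) (P * L)) _ ⟩
      count (λ x → rough (suc k) x ∧ does (P ∣? x)) (P * L) + count (rough P) (P * L)
        ≡⟨ count-partition (rough (suc k)) (λ x → does (P ∣? x)) (P * L) ⟨
      count (rough (suc k)) (P * L)
        ≡⟨ count-rough-suc ⟩
      c + suc k * c
        ≡⟨ +-comm c (suc k * c) ⟩
      suc k * c + c
        ∎
      where open ≡-Reasoning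

  count-rough-!-step : count (rough P) (P !) ≡ φ! P
  count-rough-!-step with prime? P
  ... | yes prime-P = begin
    count (rough P) (P * L)        ≡⟨ +-cancelʳ-≡ c _ _ (count-rough-prime prime-P) ⟩
    suc k * c                      ≡⟨ if-does-yes (prime? P) prime-P ⟨
    φ! P                           ∎
    where open ≡-Reasoning
  ... | no ¬prime-P = begin
    count (rough P) (P * L)        ≡⟨ count-cong _ _ (P * L) (λ x _ _ → rough-composite k ¬prime-P x) ⟩
    count (rough (suc k)) (P * L)  ≡⟨ count-rough-suc ⟩
    P * c                          ≡⟨ if-does-no (prime? P) ¬prime-P ⟨
    φ! P                           ∎
    where open ≡-Reasoning

count-rough-! : ∀ n → count (rough n) (n !) ≡ φ! n
count-rough-! zero       = refl
count-rough-! (suc zero) = refl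
count-rough-! (suc (suc k)) = count-rough-!-step k (count-rough-! (suc k))

count-rough-*-! : ∀ K q → count (rough K) (q * K !) ≡ q * φ! K
count-rough-*-! K q = trans (count-periodic _ (K !) (rough-periodic K) q) (cong (q *_) (count-rough-! K))

IsΔStar⇒small-multiple : ∀ k H → IsΔStar (suc (suc k)) H → ∀ m → 1 ≤ m →
  ∃[ j ] (1 ≤ j × j ≤ suc k × H (j * m) ≡ true)
IsΔStar⇒small-multiple k H isΔ m@(suc _) _
  with isΔ (applyUpTo multiple r) (Unique.applyUpTo⁺₁ multiple r multiple-injective)
           (All.applyUpTo⁺₂ multiple r (λ _ → s≤s z≤n)) (≤-reflexive (sym (length-applyUpTo multiple r)))
  where
  r : ℕ
  r = suc (suc k)
  multiple : ℕ → ℕ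
  multiple i = suc i * m
  multiple-injective : ∀ {i j} → i < j → j < r → multiple i ≢ multiple j
  multiple-injective i<j _ eq = <⇒≢ i<j (suc-injective (*-cancelʳ-≡ _ _ m eq))
... | a , b , a∈ , b∈ , b<a , H[a-b]
  with ∈-applyUpTo⁻ (λ i → suc i * m) a∈ | ∈-applyUpTo⁻ (λ i → suc i * m) b∈
... | i , i<r , refl | j , _ , refl =
  i ∸ j , m<n⇒0<n∸m j<i , ≤-trans (m∸n≤m i j) (≤-pred i<r) ,
  trans (cong H (trans (*-distribʳ-∸ m i j) (sym ([m+n]∸[m+o]≡n∸o m (i * m) (j * m))))) H[a-b]
  where
  j<i : j < i
  j<i = ≤-pred (*-cancelʳ-< _ (suc j) (suc i) b<a)

rough⇒coprime : ∀ K {x j} → rough K x ≡ true → 1 ≤ j → j ≤ K → Coprime x j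
rough⇒coprime K {j = suc _} _ _ _ {zero} (_ , 0∣j) with () ← 0∣⇒≡0 0∣j
rough⇒coprime K _ _ _ {suc zero} _ = refl
rough⇒coprime K rough-x 1≤j j≤K {suc (suc i)} (i+2∣x , i+2∣j) =
  contradiction i+2∣x
    (rough⇒∤ K _ rough-x (suc (suc i)) (s≤s (s≤s z≤n)) (≤-trans (∣⇒≤ {{ℕ.>-nonZero 1≤j}} i+2∣j) j≤K))

scaled-rough-injective : ∀ K {x y j j′} → rough K x ≡ true → rough K y ≡ true →
  1 ≤ j → j ≤ K → 1 ≤ j′ → j′ ≤ K → j * x ≡ j′ * y → x ≡ y
scaled-rough-injective K {x} {y} {j} {j′} rough-x rough-y 1≤j j≤K 1≤j′ j′≤K jx≡j′y = ∣-antisym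
  (coprime-divisor (rough⇒coprime K rough-x 1≤j′ j′≤K) (subst (x ∣_) jx≡j′y (n∣m*n j)))
  (coprime-divisor (rough⇒coprime K rough-y 1≤j j≤K) (subst (y ∣_) (sym jx≡j′y) (n∣m*n j′)))

count-rough≤count : ∀ k H → IsΔStar (suc (suc k)) H → ∀ M → count (rough (suc k)) M ≤ count H (suc k * M)
count-rough≤count k H isΔ M = count-≤-injection (rough K) H h M (K * M) maps-to injective
  where
  K : ℕ
  K = suc k
  multiple : ∀ m → ∃[ j ] (1 ≤ j × j ≤ K × H (j * suc m) ≡ true)
  multiple m = IsΔStar⇒small-multiple k H isΔ (suc m) (s≤s z≤n)
  h : ℕ → ℕ
  h zero    = zero
  h (suc m) = proj₁ (multiple m) * suc m
  maps-to : ∀ x → 1 ≤ x → x ≤ M → rough K x ≡ true → H (h x) ≡ true × 1 ≤ h x × h x ≤ K * M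
  maps-to (suc x) _ x≤M _ = let (j , 1≤j , j≤K , H[jx]) = multiple x in
    H[jx] , *-mono-≤ 1≤j (s≤s z≤n) , *-mono-≤ j≤K x≤M
  injective : ∀ x y → 1 ≤ x → x ≤ M → 1 ≤ y → y ≤ M →
    rough K x ≡ true → rough K y ≡ true → h x ≡ h y → x ≡ y
  injective (suc x) (suc y) _ _ _ _ rough-x rough-y =
    let (_ , 1≤j , j≤K , _) = multiple x; (_ , 1≤j′ , j′≤K , _) = multiple y in
    scaled-rough-injective K rough-x rough-y 1≤j j≤K 1≤j′ j′≤K

*-floor-≤ : ∀ a c N T .{{_ : NonZero T}} → N ℕ./ T * c ≤ a → c * N ≤ (a + c) * T
*-floor-≤ a c N T qc≤a = begin
  c * N                          ≡⟨ cong (c *_) (m≡m%n+[m/n]*n N T) ⟩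
  c * (N ℕ.% T + q * T)          ≡⟨ *-distribˡ-+ c (N ℕ.% T) (q * T) ⟩
  c * (N ℕ.% T) + c * (q * T)    ≤⟨ +-monoˡ-≤ (c * (q * T)) (*-monoʳ-≤ c (<⇒≤ (m%n<n N T))) ⟩
  c * T + c * (q * T)            ≡⟨ cong (c * T +_) (sym (*-assoc c q T)) ⟩
  c * T + c * q * T              ≡⟨ cong (λ cq → c * T + cq * T) (*-comm c q) ⟩
  c * T + q * c * T              ≤⟨ +-monoʳ-≤ (c * T) (*-monoˡ-≤ T qc≤a) ⟩
  c * T + a * T                  ≡⟨ +-comm (c * T) (a * T) ⟩
  a * T + c * T                  ≡⟨ *-distribʳ-+ T a c ⟨
  (a + c) * T                    ∎
  where
  open ≤-Reasoning
  q : ℕ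
  q = N ℕ./ T

count-lower-bound : ∀ k H → IsΔStar (suc (suc k)) H → ∀ N .{{_ : NonZero (suc k * suc k !)}} →
  N ℕ./ (suc k * suc k !) * φ! (suc k) ≤ count H N
count-lower-bound k H isΔ N = begin
  q * φ! K                ≡⟨ count-rough-*-! K q ⟨
  count (rough K) (q * L)  ≤⟨ count-rough≤count k H isΔ (q * L) ⟩
  count H (K * (q * L))    ≤⟨ count-mono H (subst (_≤ N) q*T≡K*[q*L] (m/n*n≤m N (K * L))) ⟩
  count H N                ∎
  where
  open ≤-Reasoning
  K L q : ℕ
  K = suc k
  L = K !
  q = N ℕ./ (K * L)
  q*T≡K*[q*L] : q * (K * L) ≡ K * (q * L)
  q*T≡K*[q*L] = trans (sym (*-assoc q K L)) (trans (cong (_* L) (*-comm q K)) (*-assoc K q L))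

open import Data.Integer as ℤ using (+_; +[1+_]; +0; -[1+_])
import Data.Integer.Properties as ℤP
import Data.Integer.Tactic.RingSolver as ℤSolver
open import Data.Rational as ℚ using (ℚ; mkℚ; _/_; _-_; 0ℚ; 1ℚ; toℚᵘ) renaming (_<_ to _<ℚ_; _≤_ to _≤ℚ_)
import Data.Rational.Properties as ℚP
open import Data.Rational.Unnormalised as ℚᵘ using (ℚᵘ; mkℚᵘ; _≃_; *≡*; *≤*)
import Data.Rational.Unnormalised.Properties as ℚᵘP

toℚᵘ-/ : ∀ a b .{{_ : NonZero b}} → toℚᵘ (+ a / b) ≃ + a ℚᵘ./ b
toℚᵘ-/ a (suc b) = ℚP.toℚᵘ-fromℚᵘ (mkℚᵘ (+ a) b)

/-*-/ : ∀ a b c d .{{_ : NonZero b}} .{{_ : NonZero d}} →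
  (+ a ℚᵘ./ b) ℚᵘ.* (+ c ℚᵘ./ d) ≃ ℚᵘ._/_ (+ (a * c)) (b * d) {{m*n≢0 b d}}
/-*-/ a (suc b) c (suc d) = *≡* (cong (ℤ._* + (suc b * suc d)) (sym (ℤP.pos-* a c)))

toℚᵘ-homo-minus : ∀ p q → toℚᵘ (p - q) ≃ toℚᵘ p ℚᵘ.- toℚᵘ q
toℚᵘ-homo-minus p q =
  ℚᵘP.≃-trans (ℚP.toℚᵘ-homo-+ p (ℚ.- q)) (ℚᵘP.+-congʳ (toℚᵘ p) (ℚP.toℚᵘ-homo‿- q))

1-1/[1+n] : ∀ n → toℚᵘ (1ℚ - + 1 / suc n) ≃ + n ℚᵘ./ suc n
1-1/[1+n] n = begin
  toℚᵘ (1ℚ - + 1 / suc n)                ≈⟨ toℚᵘ-homo-minus 1ℚ (+ 1 / suc n) ⟩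
  ℚᵘ.1ℚᵘ ℚᵘ.- toℚᵘ (+ 1 / suc n)         ≈⟨ ℚᵘP.+-congʳ ℚᵘ.1ℚᵘ (ℚᵘP.-‿cong (toℚᵘ-/ 1 (suc n))) ⟩
  ℚᵘ.1ℚᵘ ℚᵘ.- (+ 1 ℚᵘ./ suc n)            ≈⟨ *≡* (cong₂ (λ a b → + a ℤ.* + b) (+-identityʳ n) (sym (+-identityʳ (suc n)))) ⟩
  + n ℚᵘ./ suc n                         ∎
  where open ℚᵘP.≃-Reasoning

_/!_ : ℕ → ℕ → ℚᵘ
a /! n = ℚᵘ._/_ (+ a) (n !) {{n !≢0}}

K*K!≢0 : ∀ k → NonZero (suc k * suc k !)
K*K!≢0 k = m*n≢0 (suc k) (suc k !) {{_}} {{suc k !≢0}}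

module _ (n : ℕ) (ih : toℚᵘ (primeProd n) ≃ φ! n /! n) where
  primeProd≃φ!/!-step : toℚᵘ (primeProd (suc n)) ≃ φ! (suc n) /! suc n
  primeProd≃φ!/!-step with prime? (suc n)
  ... | yes _ = begin
    toℚᵘ (primeProd n ℚ.* (1ℚ - + 1 / suc n))        ≈⟨ ℚP.toℚᵘ-homo-* (primeProd n) _ ⟩
    toℚᵘ (primeProd n) ℚᵘ.* toℚᵘ (1ℚ - + 1 / suc n)  ≈⟨ ℚᵘP.*-cong ih (1-1/[1+n] n) ⟩
    (φ! n /! n) ℚᵘ.* (+ n ℚᵘ./ suc n)                ≈⟨ ℚᵘP.*-comm (φ! n /! n) _ ⟩
    (+ n ℚᵘ./ suc n) ℚᵘ.* (φ! n /! n)                ≈⟨ /-*-/ n (suc n) (φ! n) (n !) {{_}} {{n !≢0}} ⟩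
    (n * φ! n) /! suc n                              ∎
    where open ℚᵘP.≃-Reasoning
  ... | no _ = begin
    toℚᵘ (primeProd n)                                    ≈⟨ ih ⟩
    φ! n /! n                                             ≈⟨ ℚᵘP.*-cancelˡ-/ (suc n) {{n !≢0}} {{suc n !≢0}} ⟨
    ℚᵘ._/_ (+ suc n ℤ.* + φ! n) (suc n !) {{suc n !≢0}}  ≡⟨ cong (λ i → ℚᵘ._/_ i (suc n !) {{suc n !≢0}})
                                                               (ℤP.pos-* (suc n) (φ! n)) ⟨
    (suc n * φ! n) /! suc n                               ∎
    where open ℚᵘP.≃-Reasoning

primeProd≃φ!/! : ∀ n → toℚᵘ (primeProd n) ≃ φ! n /! n
primeProd≃φ!/! zero    = ℚᵘP.≃-refl
primeProd≃φ!/! (suc n) = primeProd≃φ!/!-step n (primeProd≃φ!/! n)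

bound≃φ!/[K*K!] : ∀ k → toℚᵘ (bound (suc (suc k))) ≃ ℚᵘ._/_ (+ φ! (suc k)) (suc k * suc k !) {{K*K!≢0 k}}
bound≃φ!/[K*K!] k = begin
  toℚᵘ (+ 1 / K ℚ.* primeProd K)                   ≈⟨ ℚP.toℚᵘ-homo-* (+ 1 / K) (primeProd K) ⟩
  toℚᵘ (+ 1 / K) ℚᵘ.* toℚᵘ (primeProd K)           ≈⟨ ℚᵘP.*-cong (toℚᵘ-/ 1 K) (primeProd≃φ!/! K) ⟩
  (+ 1 ℚᵘ./ K) ℚᵘ.* (φ! K /! K)                    ≈⟨ /-*-/ 1 K (φ! K) (K !) {{_}} {{K !≢0}} ⟩
  ℚᵘ._/_ (+ (1 * φ! K)) (K * K !) {{K*K!≢0 k}}    ≡⟨ cong (λ m → ℚᵘ._/_ (+ m) (K * K !) {{K*K!≢0 k}})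
                                                         (*-identityˡ (φ! K)) ⟩
  ℚᵘ._/_ (+ φ! K) (K * K !) {{K*K!≢0 k}}          ∎
  where
  open ℚᵘP.≃-Reasoning
  K : ℕ
  K = suc k

/-≤-/ : ∀ a b c d .{{_ : NonZero b}} .{{_ : NonZero d}} → a * d ≤ c * b → + a ℚᵘ./ b ℚᵘ.≤ + c ℚᵘ./ d
/-≤-/ a (suc b) c (suc d) ad≤cb =
  *≤* (subst₂ ℤ._≤_ (ℤP.pos-* a (suc d)) (ℤP.pos-* c (suc b)) (ℤ.+≤+ ad≤cb))

/-+-/ : ∀ a b n .{{_ : NonZero n}} → (+ a ℚᵘ./ n) ℚᵘ.+ (+ b ℚᵘ./ n) ≃ + (a + b) ℚᵘ./ n
/-+-/ a b n@(suc _) = *≡* (begin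
  (+ a ℤ.* + n ℤ.+ + b ℤ.* + n) ℤ.* + n  ≡⟨ distrib (+ a) (+ b) (+ n) ⟩
  (+ a ℤ.+ + b) ℤ.* (+ n ℤ.* + n)        ≡⟨ cong₂ ℤ._*_ (ℤP.pos-+ a b) (ℤP.pos-* n n) ⟨
  + (a + b) ℤ.* + (n * n)                ∎)
  where
  open ≡-Reasoning
  distrib : ∀ x y z → (x ℤ.* z ℤ.+ y ℤ.* z) ℤ.* z ≡ (x ℤ.+ y) ℤ.* (z ℤ.* z)
  distrib = ℤSolver.solve-∀

p≤q+r⇒r≤s⇒p-s≤q : ∀ {p q r s : ℚᵘ} → p ℚᵘ.≤ q ℚᵘ.+ r → r ℚᵘ.≤ s → p ℚᵘ.- s ℚᵘ.≤ q
p≤q+r⇒r≤s⇒p-s≤q {p} {q} {r} {s} p≤q+r r≤s = begin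
  p ℚᵘ.- s                   ≤⟨ ℚᵘP.+-mono-≤ p≤q+r (ℚᵘP.neg-mono-≤ r≤s) ⟩
  (q ℚᵘ.+ r) ℚᵘ.- r          ≃⟨ ℚᵘP.+-assoc q r (ℚᵘ.- r) ⟩
  q ℚᵘ.+ (r ℚᵘ.- r)          ≃⟨ ℚᵘP.+-congʳ q (ℚᵘP.+-inverseʳ r) ⟩
  q ℚᵘ.+ ℚᵘ.0ℚᵘ              ≃⟨ ℚᵘP.+-identityʳ q ⟩
  q                          ∎
  where open ℚᵘP.≤-Reasoning

density-gap : ∀ a c N T .{{_ : NonZero N}} .{{_ : NonZero T}} (ε : ℚᵘ) →
  c * N ≤ (a + c) * T → + c ℚᵘ./ N ℚᵘ.≤ ε → (+ c ℚᵘ./ T) ℚᵘ.- ε ℚᵘ.≤ + a ℚᵘ./ N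
density-gap a c N T ε cN≤[a+c]T c/N≤ε = p≤q+r⇒r≤s⇒p-s≤q
  (ℚᵘP.≤-respʳ-≃ (ℚᵘP.≃-sym (/-+-/ a c N)) (/-≤-/ c T (a + c) N cN≤[a+c]T)) c/N≤ε

mainTheorem5 : (r : ℕ) → 2 ≤ r → (H : ℕ → Bool) → IsΔStar r H →
    (ε : ℚ) → 0ℚ <ℚ ε →
    ∃[ N₀ ] ((N : ℕ) → .{{_ : NonZero N}} → N₀ ≤ N →
      bound r - ε ≤ℚ (+ count H N) / N)
mainTheorem5 zero ()
mainTheorem5 (suc zero) (s≤s ())
mainTheorem5 (suc (suc k)) _ H isΔ (mkℚ +0 _ _)       (ℚ.*<* (ℤ.+<+ ()))
mainTheorem5 (suc (suc k)) _ H isΔ (mkℚ -[1+ _ ] _ _) (ℚ.*<* ())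
-- The error term φ!(K)/N is at most 1/(d+1) ≤ ε once N ≥ φ!(K) (d+1).
mainTheorem5 (suc (suc k)) _ H isΔ ε@(mkℚ +[1+ e ] d _) _ = φ! K * suc d , λ N N₀≤N →
  let open ℚᵘP.≤-Reasoning in ℚP.toℚᵘ-cancel-≤ (begin
    toℚᵘ (bound (suc K) - ε)          ≃⟨ toℚᵘ-homo-minus (bound (suc K)) ε ⟩
    toℚᵘ (bound (suc K)) ℚᵘ.- toℚᵘ ε  ≃⟨ ℚᵘP.+-congˡ (ℚᵘ.- toℚᵘ ε) (bound≃φ!/[K*K!] k) ⟩
    (+ φ! K ℚᵘ./ T) ℚᵘ.- toℚᵘ ε       ≤⟨ density-gap (count H N) (φ! K) N T (toℚᵘ ε)
                                          (*-floor-≤ (count H N) (φ! K) N T (count-lower-bound k H isΔ N))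
                                          (/-≤-/ (φ! K) N (suc e) (suc d) (≤-trans N₀≤N (m≤n*m N (suc e)))) ⟩
    + count H N ℚᵘ./ N                 ≃⟨ toℚᵘ-/ (count H N) N ⟨
    toℚᵘ (+ count H N / N)             ∎)
  where
  K T : ℕ
  K = suc k
  T = K * K !
  instance
    T≢0 : NonZero T
    T≢0 = K*K!≢0 k
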